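{- Let $X$ be a finite rack. For $x\in X$ let $m_x$ be the order of the permutation $y\mapsto y^x$ of $X$, and put $z=\prod_{x\in X}x^{m_x}\in S_X$ (an element of the center of $S_X$). Then the natural monoid homomorphism $S_X[z^{ -1}]\to\Gamma_X$ is an isomorphism.
   Context: Rack: set with $(x,y)\mapsto x^y$, each $x\mapsto x^y$ bijective, $(z^x)^y=(z^y)^{x^y}$. $S_X=\langle X\mid xy=yx^y\rangle$ (structure semigroup), $\Gamma_X=\langle X\mid y^{ -1}xy=x^y\rangle$ (structure group). For a semigroup $S$ and central $z\in S$, $S[z^{ -1}]$ is the monoid with a semigroup map $\varphi:S\to S[z^{ -1}]$, $\varphi(z)$ invertible, universal among semigroup maps from $S$ to monoids sending $z$ to an invertible element. The natural map $S_X[z^{ -1}]\to\Gamma_X$ is induced by $S_X\to\Gamma_X$. -}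

module Defs where

open import Level using (0ℓ)
open import Data.Nat using (ℕ; zero; suc; _<_)
open import Data.Fin using (Fin)
open import Data.Bool using (Bool; true; false; not)
open import Data.Product using (Σ; _×_; _,_; ∃)
open import Data.List using (List; []; _∷_; _++_; map; concatMap; replicate)
open import Data.List.NonEmpty using (List⁺; _∷_; _⁺++⁺_; toList)
open import Data.Fin.Base using () renaming (zero to fzero)
open import Data.List using (allFin)
open import Relation.Binary.PropositionalEquality using (_≡_)
open import Relation.Nullary using (¬_)
open import Function.Definitions using (Bijective)
open import Algebra.Bundles using (Monoid)

-- Racks on a finite set X = Fin n.  x ^ y is written  op x y.

record Rack (n : ℕ) : Set where
  field
    op        : Fin n → Fin n → Fin n
    bij       : ∀ y → Bijective _≡_ _≡_ (λ x → op x y)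
    selfdistr : ∀ x y z → op (op z x) y ≡ op (op z y) (op x y)

iter : {A : Set} → (A → A) → ℕ → A → A
iter f zero    a = a
iter f (suc k) a = f (iter f k a)

IsOrder : {n : ℕ} → (Fin n → Fin n) → ℕ → Set
IsOrder f m = (0 < m) × (∀ y → iter f m y ≡ y)
            × (∀ k → 0 < k → k < m → ¬ (∀ y → iter f k y ≡ y))

module _ {n : ℕ} (R : Rack n) where
  open Rack R

  -- Structure semigroup S_X = ⟨ X ∣ xy = y x^y ⟩ :
  -- nonempty words modulo the congruence generated by the relations.

  data _∼S_ : List⁺ (Fin n) → List⁺ (Fin n) → Set where
    S-rel   : ∀ x y → (x ∷ (y ∷ [])) ∼S (y ∷ (op x y ∷ []))
    S-refl  : ∀ {u} → u ∼S u
    S-sym   : ∀ {u v} → u ∼S v → v ∼S u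
    S-trans : ∀ {u v w} → u ∼S v → v ∼S w → u ∼S w
    S-cong  : ∀ {u u′ v v′} → u ∼S u′ → v ∼S v′ → (u ⁺++⁺ v) ∼S (u′ ⁺++⁺ v′)

  -- Structure group Γ_X = ⟨ X ∣ y⁻¹ x y = x^y ⟩ :
  -- group words (letter, true = positive / false = inverse) modulo the
  -- congruence generated by free reduction and the defining relations.

  GWord : Set
  GWord = List (Fin n × Bool)

  data _∼Γ_ : GWord → GWord → Set where
    Γ-free  : ∀ x b → ((x , b) ∷ (x , not b) ∷ []) ∼Γ []
    Γ-rel   : ∀ x y → ((y , false) ∷ (x , true) ∷ (y , true) ∷ []) ∼Γ ((op x y , true) ∷ [])
    Γ-refl  : ∀ {u} → u ∼Γ u
    Γ-sym   : ∀ {u v} → u ∼Γ v → v ∼Γ u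
    Γ-trans : ∀ {u v w} → u ∼Γ v → v ∼Γ w → u ∼Γ w
    Γ-cong  : ∀ {u u′ v v′} → u ∼Γ u′ → v ∼Γ v′ → (u ++ v) ∼Γ (u′ ++ v′)

  ι : List⁺ (Fin n) → GWord
  ι w = map (λ x → (x , true)) (toList w)

  IsSemigroupHom : (M : Monoid 0ℓ 0ℓ) → (List⁺ (Fin n) → Monoid.Carrier M) → Set
  IsSemigroupHom M f =
    (∀ {u v} → u ∼S v → f u ≈ f v) × (∀ u v → f (u ⁺++⁺ v) ≈ (f u ∙ f v))
    where open Monoid M

IsInvertible : (M : Monoid 0ℓ 0ℓ) → Monoid.Carrier M → Set
IsInvertible M a = Σ Carrier λ b → ((a ∙ b) ≈ ε) × ((b ∙ a) ≈ ε)
  where open Monoid M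

IsMonoidHom : (M N : Monoid 0ℓ 0ℓ) → (Monoid.Carrier M → Monoid.Carrier N) → Set
IsMonoidHom M N g =
  (∀ {a b} → a M.≈ b → g a N.≈ g b) × (∀ a b → g (a M.∙ b) N.≈ (g a N.∙ g b))
  × (g M.ε N.≈ N.ε)
  where module M = Monoid M
        module N = Monoid N

module _ {n : ℕ} (R : Rack n) where
  open Rack R

  IsLocalization : (z : List⁺ (Fin n)) (M : Monoid 0ℓ 0ℓ)
                   (φ : List⁺ (Fin n) → Monoid.Carrier M) → Set₁
  IsLocalization z M φ =
    IsSemigroupHom R M φ × IsInvertible M (φ z)
    × (∀ (N : Monoid 0ℓ 0ℓ) (f : List⁺ (Fin n) → Monoid.Carrier N)
       → IsSemigroupHom R N f → IsInvertible N (f z)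
       → Σ (Monoid.Carrier M → Monoid.Carrier N) λ g →
            IsMonoidHom M N g × (∀ u → Monoid._≈_ N (g (φ u)) (f u))
            × (∀ (g′ : Monoid.Carrier M → Monoid.Carrier N)
               → IsMonoidHom M N g′ → (∀ u → Monoid._≈_ N (g′ (φ u)) (f u))
               → ∀ a → Monoid._≈_ N (g′ a) (g a)))

  IsMonoidHomToΓ : (M : Monoid 0ℓ 0ℓ) → (Monoid.Carrier M → GWord R) → Set
  IsMonoidHomToΓ M g =
    (∀ {a b} → a ≈ b → _∼Γ_ R (g a) (g b)) × (∀ a b → _∼Γ_ R (g (a ∙ b)) (g a ++ g b))
    × _∼Γ_ R (g ε) []
    where open Monoid M

-- z = ∏_{x ∈ X} x^{m_x}, product taken in the order 0,1,…,n (the factors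
-- are central, so the order is immaterial).  Needs X nonempty: X = Fin (suc k).
zWord : {k : ℕ} → (Fin (suc k) → ℕ) → List⁺ (Fin (suc k))
zWord {k} m with concatMap (λ x → replicate (m x) x) (allFin (suc k))
... | []     = fzero ∷ []   -- unreachable when all m x > 0
... | a ∷ as = a ∷ as

{-# OPTIONS --safe #-}
-- Let f be a semigroup map from S_X to a monoid.  The relation x y = y x^y moves a generator
-- y across x^j at the cost of replacing it by y^(x^j); since y ↦ y^x has order m_x, the
-- element f(x)^(m_x) commutes with every f(y).  Hence each f(x) divides f(z) on both sides,
-- so all f(x) are invertible as soon as f(z) is, and f extends to Γ_X.  For the localization
-- this extension inverts the comparison map ψ: ψ fixes the letters of group words, and the
-- extension after ψ is an endomorphism of S_X[z⁻¹] over S_X, hence the identity by the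
-- uniqueness part of the universal property.
module Submission where

open import Defs
open import Level using (0ℓ)
open import Function using (_∘_)
open import Data.Nat using (ℕ; suc; zero)
open import Data.Fin using (Fin)
open import Data.Fin.Base using () renaming (zero to fzero)
open import Data.Product using (Σ; _×_; _,_; proj₁; proj₂)
open import Data.List.NonEmpty using (List⁺; _∷_; toList)
open import Data.List using (List; []; _∷_; _++_; map; concatMap; replicate; allFin)
open import Data.List.Properties using (++-assoc; ++-identityʳ)
open import Data.List.Relation.Unary.Any using (here; there)
open import Data.List.Membership.Propositional using (_∈_)
open import Data.List.Membership.Propositional.Properties using (∈-allFin)
open import Data.Bool using (Bool; true; false)
open import Algebra.Bundles using (Monoid)
open import Relation.Binary.Bundles using (Setoid)
open import Relation.Binary.PropositionalEquality as ≡ using (_≡_)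
import Algebra.Properties.Monoid.Divisibility as Divisibility
import Relation.Binary.Reasoning.Setoid as SetoidReasoning

module _ (M : Monoid 0ℓ 0ℓ) where
  open Monoid M
  open Divisibility M
  open SetoidReasoning setoid

  left-inverse≈right-inverse : ∀ {a b c} → b ∙ a ≈ ε → a ∙ c ≈ ε → b ≈ c
  left-inverse≈right-inverse {a} {b} {c} ba≈ε ac≈ε = begin
    b             ≈⟨ identityʳ b ⟨
    b ∙ ε         ≈⟨ ∙-congˡ ac≈ε ⟨
    b ∙ (a ∙ c)   ≈⟨ assoc b a c ⟨
    (b ∙ a) ∙ c   ≈⟨ ∙-congʳ ba≈ε ⟩
    ε ∙ c         ≈⟨ identityˡ c ⟩
    c             ∎

  divisor-of-invertible-is-invertible : ∀ {a z} → a ∣ˡ z → a ∣ʳ z → IsInvertible M z → IsInvertible M a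
  divisor-of-invertible-is-invertible {a} {z} (r , ar≈z) (l , la≈z) (z⁻¹ , zz⁻¹≈ε , z⁻¹z≈ε) =
    r ∙ z⁻¹ , right-inverse ,
    trans (∙-congʳ (sym (left-inverse≈right-inverse left-inverse right-inverse))) left-inverse
    where
      right-inverse : a ∙ (r ∙ z⁻¹) ≈ ε
      right-inverse = trans (sym (assoc a r z⁻¹)) (trans (∙-congʳ ar≈z) zz⁻¹≈ε)
      left-inverse : (z⁻¹ ∙ l) ∙ a ≈ ε
      left-inverse = trans (assoc z⁻¹ l a) (trans (∙-congˡ la≈z) z⁻¹z≈ε)

  commuting-x∣ˡy⇒x∣ˡzy : ∀ {x y z} → x ∙ z ≈ z ∙ x → x ∣ˡ y → x ∣ˡ z ∙ y
  commuting-x∣ˡy⇒x∣ˡzy {x} {y} {z} xz≈zx (q , xq≈y) = z ∙ q , (begin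
    x ∙ (z ∙ q)   ≈⟨ assoc x z q ⟨
    (x ∙ z) ∙ q   ≈⟨ ∙-congʳ xz≈zx ⟩
    (z ∙ x) ∙ q   ≈⟨ assoc z x q ⟩
    z ∙ (x ∙ q)   ≈⟨ ∙-congˡ xq≈y ⟩
    z ∙ y         ∎)

  commuting-x∣ʳy⇒x∣ʳyz : ∀ {x y z} → x ∙ z ≈ z ∙ x → x ∣ʳ y → x ∣ʳ y ∙ z
  commuting-x∣ʳy⇒x∣ʳyz {x} {y} {z} xz≈zx (q , qx≈y) = q ∙ z , (begin
    (q ∙ z) ∙ x   ≈⟨ assoc q z x ⟩
    q ∙ (z ∙ x)   ≈⟨ ∙-congˡ xz≈zx ⟨
    q ∙ (x ∙ z)   ≈⟨ assoc q x z ⟨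
    (q ∙ x) ∙ z   ≈⟨ ∙-congʳ qx≈y ⟩
    y ∙ z         ∎)

module _ {n : ℕ} (R : Rack n) (z : List⁺ (Fin n)) (M : Monoid 0ℓ 0ℓ) (φ : List⁺ (Fin n) → Monoid.Carrier M)
         (loc : IsLocalization R z M φ) where
  open Monoid M

  localization-endomorphism-is-id : (g : Carrier → Carrier) → IsMonoidHom M M g
    → (∀ u → g (φ u) ≈ φ u) → ∀ a → g a ≈ a
  localization-endomorphism-is-id g g-hom gφ≈φ a
    with proj₂ (proj₂ loc) M φ (proj₁ loc) (proj₁ (proj₂ loc))
  ... | _ , _ , _ , unique =
    trans (unique g g-hom gφ≈φ a) (sym (unique (λ b → b) id-hom (λ _ → refl) a))
    where
      id-hom : IsMonoidHom M M (λ b → b)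
      id-hom = (λ a≈b → a≈b) , (λ _ _ → refl) , refl

iter-shift : {A : Set} (f : A → A) (j : ℕ) (y : A) → iter f j (f y) ≡ f (iter f j y)
iter-shift f zero    y = ≡.refl
iter-shift f (suc j) y = ≡.cong f (iter-shift f j y)

module SemigroupMap {n : ℕ} (R : Rack n) (N : Monoid 0ℓ 0ℓ) (f : List⁺ (Fin n) → Monoid.Carrier N)
                    (f-hom : IsSemigroupHom R N f) where
  open Rack R
  open Monoid N
  open Divisibility N
  open SetoidReasoning setoid

  gen : Fin n → Carrier
  gen x = f (x ∷ [])

  prod : List (Fin n) → Carrier
  prod []       = ε
  prod (x ∷ xs) = gen x ∙ prod xs

  prod-++ : ∀ xs ys → prod (xs ++ ys) ≈ prod xs ∙ prod ys
  prod-++ []       ys = sym (identityˡ (prod ys))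
  prod-++ (x ∷ xs) ys = trans (∙-congˡ (prod-++ xs ys)) (sym (assoc (gen x) (prod xs) (prod ys)))

  f≈prod : ∀ x xs → f (x ∷ xs) ≈ prod (x ∷ xs)
  f≈prod x []       = sym (identityʳ (gen x))
  f≈prod x (y ∷ ys) = trans (proj₂ f-hom (x ∷ []) (y ∷ ys)) (∙-congˡ (f≈prod y ys))

  gen-rel : ∀ x y → gen x ∙ gen y ≈ gen y ∙ gen (op x y)
  gen-rel x y = begin
    gen x ∙ gen y                  ≈⟨ proj₂ f-hom (x ∷ []) (y ∷ []) ⟨
    f (x ∷ y ∷ [])                 ≈⟨ proj₁ f-hom (S-rel x y) ⟩
    f (y ∷ op x y ∷ [])            ≈⟨ proj₂ f-hom (y ∷ []) (op x y ∷ []) ⟩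
    gen y ∙ gen (op x y)           ∎

  gen-prod-replicate : ∀ x j y →
    gen y ∙ prod (replicate j x) ≈ prod (replicate j x) ∙ gen (iter (λ w → op w x) j y)
  gen-prod-replicate x zero    y = trans (identityʳ (gen y)) (sym (identityˡ (gen y)))
  gen-prod-replicate x (suc j) y = begin
    gen y ∙ (gen x ∙ xʲ)                  ≈⟨ assoc (gen y) (gen x) xʲ ⟨
    (gen y ∙ gen x) ∙ xʲ                  ≈⟨ ∙-congʳ (gen-rel y x) ⟩
    (gen x ∙ gen (op y x)) ∙ xʲ           ≈⟨ assoc (gen x) (gen (op y x)) xʲ ⟩
    gen x ∙ (gen (op y x) ∙ xʲ)           ≈⟨ ∙-congˡ (gen-prod-replicate x j (op y x)) ⟩
    gen x ∙ (xʲ ∙ gen (iter _^x j (op y x))) ≈⟨ assoc (gen x) xʲ _ ⟨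
    (gen x ∙ xʲ) ∙ gen (iter _^x j (op y x)) ≡⟨ ≡.cong (λ w → (gen x ∙ xʲ) ∙ gen w) (iter-shift _^x j y) ⟩
    (gen x ∙ xʲ) ∙ gen (op (iter _^x j y) x) ∎
    where
      xʲ : Carrier
      xʲ = prod (replicate j x)
      _^x : Fin n → Fin n
      _^x w = op w x

  prod-replicate-comm : ∀ x j → prod (replicate j x) ∙ gen x ≈ gen x ∙ prod (replicate j x)
  prod-replicate-comm x zero    = trans (identityˡ (gen x)) (sym (identityʳ (gen x)))
  prod-replicate-comm x (suc j) = trans (assoc (gen x) _ (gen x)) (∙-congˡ (prod-replicate-comm x j))

  -- Relative to the image of f only; that is all the relations of S_X provide.
  Central : Carrier → Set
  Central a = ∀ y → gen y ∙ a ≈ a ∙ gen y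

  Central-ε : Central ε
  Central-ε y = trans (identityʳ (gen y)) (sym (identityˡ (gen y)))

  Central-∙ : ∀ {a b} → Central a → Central b → Central (a ∙ b)
  Central-∙ {a} {b} a-central b-central y = begin
    gen y ∙ (a ∙ b)   ≈⟨ assoc (gen y) a b ⟨
    (gen y ∙ a) ∙ b   ≈⟨ ∙-congʳ (a-central y) ⟩
    (a ∙ gen y) ∙ b   ≈⟨ assoc a (gen y) b ⟩
    a ∙ (gen y ∙ b)   ≈⟨ ∙-congˡ (b-central y) ⟩
    a ∙ (b ∙ gen y)   ≈⟨ assoc a b (gen y) ⟨
    (a ∙ b) ∙ gen y   ∎

  Central-resp : ∀ {a b} → a ≈ b → Central a → Central b
  Central-resp a≈b a-central y =
    trans (∙-congˡ (sym a≈b)) (trans (a-central y) (∙-congʳ a≈b))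

  module Orders (m : Fin n → ℕ) (ord : ∀ x → IsOrder (λ y → op y x) (m x)) where

    power : Fin n → Carrier
    power x = prod (replicate (m x) x)

    power-central : ∀ x → Central (power x)
    power-central x y =
      trans (gen-prod-replicate x (m x) y) (∙-congˡ (reflexive (≡.cong gen (proj₁ (proj₂ (ord x)) y))))

    prodPowers : List (Fin n) → Carrier
    prodPowers ys = prod (concatMap (λ x → replicate (m x) x) ys)

    prodPowers-∷ : ∀ y ys → prodPowers (y ∷ ys) ≈ power y ∙ prodPowers ys
    prodPowers-∷ y ys = prod-++ (replicate (m y) y) (concatMap (λ x → replicate (m x) x) ys)

    prodPowers-central : ∀ ys → Central (prodPowers ys)
    prodPowers-central []       = Central-ε
    prodPowers-central (y ∷ ys) =
      Central-resp (sym (prodPowers-∷ y ys)) (Central-∙ (power-central y) (prodPowers-central ys))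

    gen∣power : ∀ x → gen x ∣ˡ power x × gen x ∣ʳ power x
    gen∣power x with m x | proj₁ (ord x)
    ... | zero  | ()
    ... | suc j | _ = (prod (replicate j x) , refl) , (prod (replicate j x) , prod-replicate-comm x j)

    gen∣prodPowers : ∀ {x ys} → x ∈ ys → gen x ∣ˡ prodPowers ys × gen x ∣ʳ prodPowers ys
    gen∣prodPowers {x} {.x ∷ ys} (here ≡.refl) with gen∣power x
    ... | x∣ˡ , x∣ʳ =
      ∣ˡ-respʳ-≈ (sym (prodPowers-∷ x ys)) (x∣ˡy⇒x∣ˡyz (prodPowers ys) x∣ˡ) ,
      ∣ʳ-respʳ-≈ (sym (prodPowers-∷ x ys))
               (commuting-x∣ʳy⇒x∣ʳyz N (prodPowers-central ys x) x∣ʳ)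
    gen∣prodPowers {x} {y ∷ ys} (there x∈ys) with gen∣prodPowers x∈ys
    ... | x∣ˡ , x∣ʳ =
      ∣ˡ-respʳ-≈ (sym (prodPowers-∷ y ys))
               (commuting-x∣ˡy⇒x∣ˡzy N (power-central y x) x∣ˡ) ,
      ∣ʳ-respʳ-≈ (sym (prodPowers-∷ y ys)) (x∣ʳy⇒x∣ʳzy (power y) x∣ʳ)

  module Extension (gen-invertible : ∀ x → IsInvertible N (gen x)) where

    gen⁻¹ : Fin n → Carrier
    gen⁻¹ x = proj₁ (gen-invertible x)

    letter : Fin n × Bool → Carrier
    letter (x , true)  = gen x
    letter (x , false) = gen⁻¹ x

    extend : GWord R → Carrier
    extend []      = ε
    extend (l ∷ w) = letter l ∙ extend w

    extend-++ : ∀ u v → extend (u ++ v) ≈ extend u ∙ extend v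
    extend-++ []      v = sym (identityˡ (extend v))
    extend-++ (l ∷ u) v = trans (∙-congˡ (extend-++ u v)) (sym (assoc (letter l) (extend u) (extend v)))

    extend-resp : ∀ {u v} → _∼Γ_ R u v → extend u ≈ extend v
    extend-resp (Γ-free x true)  = trans (∙-congˡ (identityʳ (gen⁻¹ x))) (proj₁ (proj₂ (gen-invertible x)))
    extend-resp (Γ-free x false) = trans (∙-congˡ (identityʳ (gen x))) (proj₂ (proj₂ (gen-invertible x)))
    extend-resp (Γ-rel x y) = begin
      gen⁻¹ y ∙ (gen x ∙ (gen y ∙ ε))   ≈⟨ ∙-congˡ (∙-congˡ (identityʳ (gen y))) ⟩
      gen⁻¹ y ∙ (gen x ∙ gen y)         ≈⟨ ∙-congˡ (gen-rel x y) ⟩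
      gen⁻¹ y ∙ (gen y ∙ gen (op x y))  ≈⟨ assoc (gen⁻¹ y) (gen y) _ ⟨
      (gen⁻¹ y ∙ gen y) ∙ gen (op x y)  ≈⟨ ∙-congʳ (proj₂ (proj₂ (gen-invertible y))) ⟩
      ε ∙ gen (op x y)                  ≈⟨ identityˡ _ ⟩
      gen (op x y)                      ≈⟨ identityʳ _ ⟨
      gen (op x y) ∙ ε                  ∎
    extend-resp Γ-refl          = refl
    extend-resp (Γ-sym u∼v)     = sym (extend-resp u∼v)
    extend-resp (Γ-trans u∼v v∼w) = trans (extend-resp u∼v) (extend-resp v∼w)
    extend-resp (Γ-cong {u} {u′} {v} {v′} u∼u′ v∼v′) = begin
      extend (u ++ v)           ≈⟨ extend-++ u v ⟩
      extend u ∙ extend v       ≈⟨ ∙-cong (extend-resp u∼u′) (extend-resp v∼v′) ⟩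
      extend u′ ∙ extend v′     ≈⟨ extend-++ u′ v′ ⟨
      extend (u′ ++ v′)         ∎

    extend-positive : ∀ xs → extend (map (λ x → x , true) xs) ≈ prod xs
    extend-positive []       = refl
    extend-positive (x ∷ xs) = ∙-congˡ (extend-positive xs)

    extend-ι : ∀ u → extend (ι R u) ≈ f u
    extend-ι (x ∷ xs) = trans (extend-positive (x ∷ xs)) (sym (f≈prod x xs))

module _ {k : ℕ} (R : Rack (suc k)) (m : Fin (suc k) → ℕ)
         (ord : ∀ x → IsOrder (λ y → Rack.op R y x) (m x)) where

  -- The default branch in the definition of zWord is excluded by m 0 > 0.
  toList-zWord : toList (zWord m) ≡ concatMap (λ x → replicate (m x) x) (allFin (suc k))
  toList-zWord with concatMap (λ x → replicate (m x) x) (allFin (suc k)) in eq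
  ... | a ∷ as = ≡.refl
  ... | [] with m fzero | proj₁ (ord fzero)
  ...   | zero  | ()
  ...   | suc j | _ with () ← eq

  generators-invertible : (N : Monoid 0ℓ 0ℓ) (f : List⁺ (Fin (suc k)) → Monoid.Carrier N)
    (f-hom : IsSemigroupHom R N f) → IsInvertible N (f (zWord m))
    → ∀ x → IsInvertible N (SemigroupMap.gen R N f f-hom x)
  generators-invertible N f f-hom z-invertible x =
    divisor-of-invertible-is-invertible N
      (∣ˡ-respʳ-≈ f-zWord x∣ˡz) (∣ʳ-respʳ-≈ f-zWord x∣ʳz) z-invertible
    where
      open Monoid N
      open Divisibility N
      open SemigroupMap R N f f-hom
      open Orders m ord

      f-zWord : prodPowers (allFin (suc k)) ≈ f (zWord m)
      f-zWord with zWord m | toList-zWord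
      ... | a ∷ as | eq = trans (reflexive (≡.cong prod (≡.sym eq))) (sym (f≈prod a as))

      x∣ˡz : gen x ∣ˡ prodPowers (allFin (suc k))
      x∣ˡz = proj₁ (gen∣prodPowers (∈-allFin x))

      x∣ʳz : gen x ∣ʳ prodPowers (allFin (suc k))
      x∣ʳz = proj₂ (gen∣prodPowers (∈-allFin x))

Γ-setoid : ∀ {n} → Rack n → Setoid 0ℓ 0ℓ
Γ-setoid R = record
  { Carrier       = GWord R
  ; _≈_           = _∼Γ_ R
  ; isEquivalence = record { refl = Γ-refl ; sym = Γ-sym ; trans = Γ-trans }
  }

module _ {n : ℕ} (R : Rack n) where
  open SetoidReasoning (Γ-setoid R)

  right-inverse-of-letter : ∀ {w x} → _∼Γ_ R (w ++ (x , true) ∷ []) [] → _∼Γ_ R w ((x , false) ∷ [])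
  right-inverse-of-letter {w} {x} wx∼[] = begin
    w                                           ≡⟨ ++-identityʳ w ⟨
    w ++ []                                     ≈⟨ Γ-cong (Γ-refl {u = w}) (Γ-sym (Γ-free x true)) ⟩
    w ++ (x , true) ∷ (x , false) ∷ []          ≡⟨ ++-assoc w _ _ ⟨
    (w ++ (x , true) ∷ []) ++ (x , false) ∷ []  ≈⟨ Γ-cong wx∼[] Γ-refl ⟩
    (x , false) ∷ []                            ∎

module ComparisonMap {n : ℕ} (R : Rack n) (z : List⁺ (Fin n)) (M : Monoid 0ℓ 0ℓ)
  (φ : List⁺ (Fin n) → Monoid.Carrier M) (loc : IsLocalization R z M φ)
  (gen-invertible : ∀ x → IsInvertible M (SemigroupMap.gen R M φ (proj₁ loc) x))
  (ψ : Monoid.Carrier M → GWord R) (ψ-hom : IsMonoidHomToΓ R M ψ)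
  (ψ∘φ≈ι : ∀ u → _∼Γ_ R (ψ (φ u)) (ι R u)) where

  open Monoid M
  open SemigroupMap R M φ (proj₁ loc)
  open Extension gen-invertible

  private
    _∼_ : GWord R → GWord R → Set
    _∼_ = _∼Γ_ R

    ψ-cong : ∀ {a b} → a ≈ b → ψ a ∼ ψ b
    ψ-cong = proj₁ ψ-hom

    ψ-∙ : ∀ a b → ψ (a ∙ b) ∼ (ψ a ++ ψ b)
    ψ-∙ = proj₁ (proj₂ ψ-hom)

    ψ-ε : ψ ε ∼ []
    ψ-ε = proj₂ (proj₂ ψ-hom)

  extend∘ψ≈id : ∀ a → extend (ψ a) ≈ a
  extend∘ψ≈id = localization-endomorphism-is-id R z M φ loc (extend ∘ ψ) extend∘ψ-hom
                  (λ u → trans (extend-resp (ψ∘φ≈ι u)) (extend-ι u))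
    where
      extend∘ψ-hom : IsMonoidHom M M (extend ∘ ψ)
      extend∘ψ-hom = (λ a≈b → extend-resp (ψ-cong a≈b))
                   , (λ a b → trans (extend-resp (ψ-∙ a b)) (extend-++ (ψ a) (ψ b)))
                   , extend-resp ψ-ε

  ψ-letter : ∀ l → ψ (letter l) ∼ (l ∷ [])
  ψ-letter (x , true)  = ψ∘φ≈ι (x ∷ [])
  ψ-letter (x , false) = right-inverse-of-letter R (begin
    ψ (gen⁻¹ x) ++ (x , true) ∷ []   ≈⟨ Γ-cong (Γ-refl {u = ψ (gen⁻¹ x)}) (Γ-sym (ψ∘φ≈ι (x ∷ []))) ⟩
    ψ (gen⁻¹ x) ++ ψ (gen x)         ≈⟨ ψ-∙ (gen⁻¹ x) (gen x) ⟨
    ψ (gen⁻¹ x ∙ gen x)              ≈⟨ ψ-cong (proj₂ (proj₂ (gen-invertible x))) ⟩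
    ψ ε                              ≈⟨ ψ-ε ⟩
    []                               ∎)
    where open SetoidReasoning (Γ-setoid R)

  ψ∘extend≈id : ∀ w → ψ (extend w) ∼ w
  ψ∘extend≈id []      = ψ-ε
  ψ∘extend≈id (l ∷ w) = Γ-trans (ψ-∙ (letter l) (extend w)) (Γ-cong (ψ-letter l) (ψ∘extend≈id w))

  ψ-injective : ∀ {a b} → ψ a ∼ ψ b → a ≈ b
  ψ-injective {a} {b} ψa∼ψb =
    trans (sym (extend∘ψ≈id a)) (trans (extend-resp ψa∼ψb) (extend∘ψ≈id b))

  ψ-surjective : ∀ w → Σ Carrier λ a → ψ a ∼ w
  ψ-surjective w = extend w , ψ∘extend≈id w

mainTheorem14 : ∀ {k : ℕ} (R : Rack (suc k)) (m : Fin (suc k) → ℕ)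
    → (∀ x → IsOrder (λ y → Rack.op R y x) (m x))
    → (M : Monoid 0ℓ 0ℓ) (φ : List⁺ (Fin (suc k)) → Monoid.Carrier M)
    → IsLocalization R (zWord m) M φ
    → (ψ : Monoid.Carrier M → GWord R)
    → IsMonoidHomToΓ R M ψ
    → (∀ u → _∼Γ_ R (ψ (φ u)) (ι R u))
    → (∀ {a b} → _∼Γ_ R (ψ a) (ψ b) → Monoid._≈_ M a b)
      × (∀ w → Σ (Monoid.Carrier M) λ a → _∼Γ_ R (ψ a) w)
mainTheorem14 R m ord M φ loc@(φ-hom , φz-invertible , _) ψ ψ-hom ψ∘φ≈ι =
  ψ-injective , ψ-surjective
  where
    open ComparisonMap R (zWord m) M φ loc
           (generators-invertible R m ord M φ φ-hom φz-invertible) ψ ψ-hom ψ∘φ≈ι
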